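{- Let $n\ge2$ be an integer, let $x\in[n,(3n-1)/2]$, let $\ell\in\{2,\dots,n\}$, and let $y,F\in\mathbb{R}$ with $y=2(x-n)+\ell-1\le F<y+1$. Let $\mathbf{a}=(a_2,\dots,a_{n+1})\in\mathbb{R}^n$ with $a_2=\cdots=a_\ell=1$ and $a_k=2-\frac{2F-y}{F+1}\big(\frac{F}{F+1}\big)^{k-\ell-1}$ for $k=\ell+1,\dots,n+1$ (equivalently, $A_k(x,\mathbf{a})/a_k=F$ for $k=\ell+1,\dots,n+1$). Set $\theta=\big(F/(F+1)\big)^{n+1-\ell}$. Then $\mathbf{a}\in\mathcal{A}(x)$ if and only if \[ (1-2\theta)x=2F(1-\theta)-\theta(2n-\ell+1). \] Moreover, if this equality holds then $\theta\ne 1/2$.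
   Context: For $\mathbf{a}=(a_2,\dots,a_{n+1})\in\mathbb{R}^n$, $x\in\mathbb{R}$ and $2\le k\le n+1$, $A_k(x,\mathbf{a})=2x-2(n-k+1)-\sum_{i=2}^k a_i$. For real $x\ge n$, $\mathcal{A}(x)=\{\mathbf{a}\in\mathbb{R}^n:\ 1=a_2\le\cdots\le a_{n+1},\ a_2+\cdots+a_{n+1}=x\}$. -}

module Defs where

open import Level using (0ℓ)
open import Data.Nat as ℕ using (ℕ; zero; suc)
open import Data.Product using (_×_; ∃)
open import Data.Empty using (⊥)
open import Relation.Nullary using (¬_)
open import Relation.Binary.PropositionalEquality using (_≡_)
open import Algebra.Structures using (IsCommutativeRing)
open import Relation.Binary.Structures using (IsTotalOrder)

-- The real numbers, axiomatised as a Dedekind-complete ordered field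
-- (this characterises ℝ up to unique isomorphism). Division is made total
-- via the convention 0⁻¹ = 0 (only ever used at nonzero arguments here).
record RealField : Set₁ where
  infixl 6 _+_ _-_
  infixl 7 _*_ _/_
  infix 4 _≤_ _<_
  field
    Carrier : Set
    0r 1r : Carrier
    _+_ _*_ : Carrier → Carrier → Carrier
    -_ : Carrier → Carrier
    _⁻¹ : Carrier → Carrier
    _≤_ : Carrier → Carrier → Set
    isCommutativeRing : IsCommutativeRing _≡_ _+_ _*_ -_ 0r 1r
    0≢1 : ¬ (0r ≡ 1r)
    ⁻¹-inverse : ∀ x → ¬ (x ≡ 0r) → x * (x ⁻¹) ≡ 1r
    0⁻¹ : 0r ⁻¹ ≡ 0r
    isTotalOrder : IsTotalOrder _≡_ _≤_
    +-monoˡ-≤ : ∀ {x y} z → x ≤ y → x + z ≤ y + z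
    *-nonneg : ∀ {x y} → 0r ≤ x → 0r ≤ y → 0r ≤ x * y
    sup : (P : Carrier → Set) → ∃ P → ∃ (λ b → ∀ z → P z → z ≤ b) →
          ∃ (λ s → (∀ z → P z → z ≤ s) ×
                   (∀ b → (∀ z → P z → z ≤ b) → s ≤ b))

  _-_ : Carrier → Carrier → Carrier
  x - y = x + (- y)

  _/_ : Carrier → Carrier → Carrier
  x / y = x * (y ⁻¹)

  _<_ : Carrier → Carrier → Set
  x < y = (x ≤ y) × ¬ (x ≡ y)

module RealOps (R : RealField) where
  open RealField R public

  fromℕ : ℕ → Carrier
  fromℕ zero = 0r
  fromℕ (suc m) = 1r + fromℕ m

  infixr 8 _^_
  _^_ : Carrier → ℕ → Carrier
  x ^ zero = 1r
  x ^ suc m = x * (x ^ m)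

  sumFrom : (ℕ → Carrier) → ℕ → ℕ → Carrier
  sumFrom a m zero = 0r
  sumFrom a m (suc c) = a m + sumFrom a (suc m) c

  -- A vector a = (a_2,…,a_{n+1}) ∈ ℝ^n is represented by a : ℕ → ℝ, of which
  -- only the values at indices 2,…,n+1 are used.
  -- 𝒜(x) = { a : 1 = a_2 ≤ ⋯ ≤ a_{n+1}, a_2 + ⋯ + a_{n+1} = x }
  InA : (n : ℕ) → Carrier → (ℕ → Carrier) → Set
  InA n x a =
    (a 2 ≡ 1r) ×
    ((k : ℕ) → 2 ℕ.≤ k → k ℕ.< suc n → a k ≤ a (suc k)) ×
    (sumFrom a 2 n ≡ x)

{-# OPTIONS --safe #-}

-- Write ℓ = l + 1, n = l + m, r = F/(F+1) and c = (2F - y)/(F+1), so that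
-- a_{ℓ+1+j} = 2 - c r^j for j < m.  Since 1 - r = 1/(F+1), the geometric
-- part telescopes: a₂ + ⋯ + a_{n+1} = l + 2m - (2F - y)(1 - θ), and after
-- substituting y the condition "sum = x" is exactly the stated equation.
-- Monotonicity is automatic: the jump at ℓ is 1 - c = (y + 1 - F)/(F+1) ≥ 0
-- and the later steps are c r^j/(F+1) ≥ 0.  If in addition θ = 1/2, the
-- equation forces 2F = p := 2n - ℓ + 1 ∈ ℕ, and θ = (p/(p+2))^m = 1/2 becomes
-- 2 p^m = (p+2)^m with p ≥ 3, m ≥ 1.  For odd p the right side is odd; for
-- p = 2K it reduces to 2 K^m = (K+1)^m, whose right side is 1 modulo K ≥ 2.

module Submission where

open import Defs
open import Level using (0ℓ)
open import Data.Nat as ℕ using (ℕ; zero; suc; _∸_; z≤n; s≤s)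
import Data.Nat.Properties as ℕP
open import Data.Nat.Divisibility
  using (_∣_; ∣-refl; ∣1⇒≡1; ∣m+n∣m⇒∣n; ∣m⇒∣m*n; m∣m*n; ∣n⇒∣m*n)
import Data.Nat.Tactic.RingSolver as ℕSolver
open import Data.Integer as ℤ using (ℤ; -[1+_]; _⊖_)
open import Data.List using ([]; _∷_)
open import Data.Maybe using (Maybe; map)
open import Data.Product using (_×_; _,_; ∃-syntax)
open import Data.Sum using (_⊎_; inj₁; inj₂)
open import Data.Empty using (⊥-elim)
open import Function.Bundles using (_⇔_; mk⇔; Equivalence)
open import Relation.Nullary using (¬_)
open import Relation.Nullary.Decidable using (dec⇒maybe)
open import Relation.Binary.PropositionalEquality as ≡
  using (_≡_; _≢_; refl; sym; trans; cong; cong₂; subst; subst₂; module ≡-Reasoning)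
open import Relation.Binary.Definitions using (tri<; tri≈; tri>)
open import Relation.Binary.Structures using (IsTotalOrder)
open import Algebra.Bundles using (CommutativeRing)
open import Algebra.Solver.Ring.AlmostCommutativeRing
  using (_-Raw-AlmostCommutative⟶_; fromCommutativeRing)
import Algebra.Properties.CommutativeSemigroup as CommutativeSemigroupProperties

module Arithmetic where
  open import Data.Nat using (_+_; _*_; _^_; _≤_; _<_)

  even-or-odd : ∀ p → ∃[ k ] (p ≡ 2 * k ⊎ p ≡ 1 + 2 * k)
  even-or-odd zero = 0 , inj₁ refl
  even-or-odd (suc p) with even-or-odd p
  ... | k , inj₁ refl = k , inj₂ refl
  ... | k , inj₂ refl = suc k , inj₁ (ℕSolver.solve (k ∷ []))

  ^-distribʳ-* : ∀ a b m → (a * b) ^ m ≡ a ^ m * b ^ m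
  ^-distribʳ-* a b zero = refl
  ^-distribʳ-* a b (suc m) =
    trans (cong (a * b *_) (^-distribʳ-* a b m)) (interchange a b (a ^ m) (b ^ m))
    where open CommutativeSemigroupProperties ℕP.*-commutativeSemigroup using (interchange)

  ∣b∧∣[1+b]^m⇒≡1 : ∀ {d b} m → d ∣ b → d ∣ (1 + b) ^ m → d ≡ 1
  ∣b∧∣[1+b]^m⇒≡1 zero _ d∣1 = ∣1⇒≡1 d∣1
  ∣b∧∣[1+b]^m⇒≡1 {d} {b} (suc m) d∣b d∣[1+b]^[1+m] = ∣b∧∣[1+b]^m⇒≡1 m d∣b
    (∣m+n∣m⇒∣n (subst (d ∣_) (ℕP.+-comm _ (b * _)) d∣[1+b]^[1+m]) (∣m⇒∣m*n _ d∣b))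

  2[1+2k]^m≢[3+2k]^m : ∀ k m → 2 * (1 + 2 * k) ^ m ≢ (1 + 2 * k + 2) ^ m
  2[1+2k]^m≢[3+2k]^m k m eq = ℕP.1+n≢n (∣b∧∣[1+b]^m⇒≡1 m (m∣m*n (suc k)) 2∣[1+2[1+k]]^m)
    where
    1+2k+2≡1+2[1+k] : 1 + 2 * k + 2 ≡ 1 + 2 * suc k
    1+2k+2≡1+2[1+k] = ℕSolver.solve (k ∷ [])
    2∣[1+2[1+k]]^m : 2 ∣ (1 + 2 * suc k) ^ m
    2∣[1+2[1+k]]^m = subst (2 ∣_) (trans eq (cong (_^ m) 1+2k+2≡1+2[1+k])) (m∣m*n ((1 + 2 * k) ^ m))

  2[2K]^m≢[2K+2]^m : ∀ K m → 2 ≤ K → 1 ≤ m → 2 * (2 * K) ^ m ≢ (2 * K + 2) ^ m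
  2[2K]^m≢[2K+2]^m K (suc m) 2≤K _ eq =
    ℕP.<⇒≢ 2≤K (sym (∣b∧∣[1+b]^m⇒≡1 (suc m) ∣-refl K∣[1+K]^m))
    where
    open ≡-Reasoning
    open CommutativeSemigroupProperties ℕP.*-commutativeSemigroup using (x∙yz≈y∙xz)
    2K+2≡2[1+K] : 2 * K + 2 ≡ 2 * (1 + K)
    2K+2≡2[1+K] = ℕSolver.solve (K ∷ [])
    2K^m≡[1+K]^m : 2 * K ^ suc m ≡ (1 + K) ^ suc m
    2K^m≡[1+K]^m = ℕP.*-cancelˡ-≡ _ _ (2 ^ suc m) {{ℕP.m^n≢0 2 (suc m)}} (begin
      2 ^ suc m * (2 * K ^ suc m) ≡⟨ x∙yz≈y∙xz (2 ^ suc m) 2 (K ^ suc m) ⟩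
      2 * (2 ^ suc m * K ^ suc m) ≡⟨ cong (2 *_) (^-distribʳ-* 2 K (suc m)) ⟨
      2 * (2 * K) ^ suc m ≡⟨ eq ⟩
      (2 * K + 2) ^ suc m ≡⟨ cong (_^ suc m) 2K+2≡2[1+K] ⟩
      (2 * (1 + K)) ^ suc m ≡⟨ ^-distribʳ-* 2 (1 + K) (suc m) ⟩
      2 ^ suc m * (1 + K) ^ suc m ∎)
    K∣[1+K]^m : K ∣ (1 + K) ^ suc m
    K∣[1+K]^m = subst (K ∣_) 2K^m≡[1+K]^m (∣n⇒∣m*n 2 (m∣m*n _))

  2p^m≢[p+2]^m : ∀ {p m} → 3 ≤ p → 1 ≤ m → 2 * p ^ m ≢ (p + 2) ^ m
  2p^m≢[p+2]^m {p} {m} 3≤p 1≤m with even-or-odd p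
  ... | k , inj₂ refl = 2[1+2k]^m≢[3+2k]^m k m
  ... | K , inj₁ refl = 2[2K]^m≢[2K+2]^m K m (ℕP.*-cancelˡ-< 2 1 K 3≤p) 1≤m

  2[l+m]∸[1+l]+1≡l+[m+m] : ∀ l m → 1 ≤ l → 2 * (l + m) ∸ suc l + 1 ≡ l + (m + m)
  2[l+m]∸[1+l]+1≡l+[m+m] (suc k) m _ = begin
    2 * (suc k + m) ∸ suc (suc k) + 1
      ≡⟨ cong (λ t → t ∸ suc (suc k) + 1) 2[1+k+m]≡2+k+[k+[m+m]] ⟩
    suc (suc k) + (k + (m + m)) ∸ suc (suc k) + 1
      ≡⟨ cong (_+ 1) (ℕP.m+n∸m≡n (suc (suc k)) _) ⟩
    k + (m + m) + 1
      ≡⟨ ℕP.+-comm _ 1 ⟩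
    suc k + (m + m) ∎
    where
    open ≡-Reasoning
    2[1+k+m]≡2+k+[k+[m+m]] : 2 * (suc k + m) ≡ suc (suc k) + (k + (m + m))
    2[1+k+m]≡2+k+[k+[m+m]] = ℕSolver.solve (k ∷ m ∷ [])

open Arithmetic

module IntegerCoefficientRingSolver {c ℓ} (R : CommutativeRing c ℓ) where
  open CommutativeRing R renaming (refl to ≈-refl; sym to ≈-sym; trans to ≈-trans)
  open import Data.Integer using (+_)
  open import Data.Integer.Properties using ([1+m]⊖[1+n]≡m⊖n; pos-*; neg-distribˡ-*; neg-distribʳ-*)
  open import Algebra.Properties.Ring ring
    using (-0#≈0#; -‿involutive; -‿+-comm; -‿distribˡ-*; -‿distribʳ-*; xyx⁻¹≈y)
  open import Algebra.Properties.Semiring.Mult semiring using (×-homo-+; ×1-homo-*)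
    renaming (_×_ to _·_)
  open import Relation.Binary.Reasoning.Setoid setoid

  ⟦_⟧· : ℤ → Carrier
  ⟦ + n ⟧· = n · 1#
  ⟦ -[1+ n ] ⟧· = - (suc n · 1#)

  -‿homo· : ∀ i → ⟦ ℤ.- i ⟧· ≈ - ⟦ i ⟧·
  -‿homo· (+ zero) = ≈-sym -0#≈0#
  -‿homo· (+ suc n) = ≈-refl
  -‿homo· -[1+ n ] = ≈-sym (-‿involutive _)

  ⊖-homo· : ∀ m n → ⟦ m ⊖ n ⟧· ≈ m · 1# - n · 1#
  ⊖-homo· zero zero = ≈-sym (-‿inverseʳ 0#)
  ⊖-homo· zero (suc n) = ≈-sym (+-identityˡ _)
  ⊖-homo· (suc m) zero = ≈-sym (≈-trans (+-congˡ -0#≈0#) (+-identityʳ _))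
  ⊖-homo· (suc m) (suc n) = begin
    ⟦ suc m ⊖ suc n ⟧·                       ≡⟨ cong ⟦_⟧· ([1+m]⊖[1+n]≡m⊖n m n) ⟩
    ⟦ m ⊖ n ⟧·                               ≈⟨ ⊖-homo· m n ⟩
    m · 1# - n · 1#                          ≈⟨ +-congʳ (xyx⁻¹≈y 1# (m · 1#)) ⟨
    1# + m · 1# - 1# - n · 1#                ≈⟨ +-assoc _ _ _ ⟩
    1# + m · 1# + (- 1# - n · 1#)            ≈⟨ +-congˡ (-‿+-comm 1# (n · 1#)) ⟩
    suc m · 1# - suc n · 1#                  ∎

  +-homo· : ∀ i j → ⟦ i ℤ.+ j ⟧· ≈ ⟦ i ⟧· + ⟦ j ⟧·
  +-homo· (+ m) (+ n) = ×-homo-+ 1# m n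
  +-homo· (+ m) -[1+ n ] = ⊖-homo· m (suc n)
  +-homo· -[1+ m ] (+ n) = ≈-trans (⊖-homo· n (suc m)) (+-comm _ _)
  +-homo· -[1+ m ] -[1+ n ] = begin
    - (suc (suc (m ℕ.+ n)) · 1#)             ≡⟨ cong (λ k → - (suc k · 1#)) (ℕP.+-suc m n) ⟨
    - ((suc m ℕ.+ suc n) · 1#)               ≈⟨ -‿cong (×-homo-+ 1# (suc m) (suc n)) ⟩
    - (suc m · 1# + suc n · 1#)              ≈⟨ -‿+-comm _ _ ⟨
    - (suc m · 1#) - suc n · 1#              ∎

  *-homo·⁺ : ∀ i n → ⟦ i ℤ.* + n ⟧· ≈ ⟦ i ⟧· * n · 1#
  *-homo·⁺ (+ m) n = ≈-trans (reflexive (cong ⟦_⟧· (≡.sym (pos-* m n)))) (×1-homo-* m n)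
  *-homo·⁺ -[1+ m ] n = begin
    ⟦ -[1+ m ] ℤ.* + n ⟧·                    ≡⟨ cong ⟦_⟧· (neg-distribˡ-* (+ suc m) (+ n)) ⟨
    ⟦ ℤ.- (+ suc m ℤ.* + n) ⟧·               ≡⟨ cong (λ i → ⟦ ℤ.- i ⟧·) (pos-* (suc m) n) ⟨
    ⟦ ℤ.- (+ (suc m ℕ.* n)) ⟧·               ≈⟨ -‿homo· (+ (suc m ℕ.* n)) ⟩
    - ((suc m ℕ.* n) · 1#)                   ≈⟨ -‿cong (×1-homo-* (suc m) n) ⟩
    - (suc m · 1# * n · 1#)                  ≈⟨ -‿distribˡ-* _ _ ⟩
    - (suc m · 1#) * n · 1#                  ∎

  *-homo· : ∀ i j → ⟦ i ℤ.* j ⟧· ≈ ⟦ i ⟧· * ⟦ j ⟧·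
  *-homo· i (+ n) = *-homo·⁺ i n
  *-homo· i -[1+ n ] = begin
    ⟦ i ℤ.* -[1+ n ] ⟧·                      ≡⟨ cong ⟦_⟧· (neg-distribʳ-* i (+ suc n)) ⟨
    ⟦ ℤ.- (i ℤ.* + suc n) ⟧·                 ≈⟨ -‿homo· (i ℤ.* + suc n) ⟩
    - ⟦ i ℤ.* + suc n ⟧·                     ≈⟨ -‿cong (*-homo·⁺ i (suc n)) ⟩
    - (⟦ i ⟧· * suc n · 1#)                  ≈⟨ -‿distribʳ-* _ _ ⟩
    ⟦ i ⟧· * - (suc n · 1#)                  ∎

  -- Same as ⟦_⟧· except that 1 goes to 1# rather than 1# + 0#, so that
  -- the solver's constant 1 is literally 1#.
  ι : ℕ → Carrier
  ι zero = 0#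
  ι (suc zero) = 1#
  ι n@(suc (suc _)) = n · 1#

  ⟦_⟧ℤ : ℤ → Carrier
  ⟦ + n ⟧ℤ = ι n
  ⟦ -[1+ n ] ⟧ℤ = - ι (suc n)

  ι≈·1 : ∀ n → ι n ≈ n · 1#
  ι≈·1 zero = ≈-refl
  ι≈·1 (suc zero) = ≈-sym (+-identityʳ 1#)
  ι≈·1 (suc (suc n)) = ≈-refl

  ⟦⟧ℤ≈⟦⟧· : ∀ i → ⟦ i ⟧ℤ ≈ ⟦ i ⟧·
  ⟦⟧ℤ≈⟦⟧· (+ n) = ι≈·1 n
  ⟦⟧ℤ≈⟦⟧· -[1+ n ] = -‿cong (ι≈·1 (suc n))

  homomorphism : ℤ.+-*-rawRing -Raw-AlmostCommutative⟶ fromCommutativeRing R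
  homomorphism = record
    { ⟦_⟧    = ⟦_⟧ℤ
    ; +-homo = λ i j → ≈-trans (⟦⟧ℤ≈⟦⟧· (i ℤ.+ j))
                         (≈-trans (+-homo· i j) (≈-sym (+-cong (⟦⟧ℤ≈⟦⟧· i) (⟦⟧ℤ≈⟦⟧· j))))
    ; *-homo = λ i j → ≈-trans (⟦⟧ℤ≈⟦⟧· (i ℤ.* j))
                         (≈-trans (*-homo· i j) (≈-sym (*-cong (⟦⟧ℤ≈⟦⟧· i) (⟦⟧ℤ≈⟦⟧· j))))
    ; -‿homo = λ i → ≈-trans (⟦⟧ℤ≈⟦⟧· (ℤ.- i))
                       (≈-trans (-‿homo· i) (-‿cong (≈-sym (⟦⟧ℤ≈⟦⟧· i))))
    ; 0-homo = ≈-refl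
    ; 1-homo = ≈-refl
    }

  ⟦⟧ℤ-equal? : ∀ i j → Maybe (⟦ i ⟧ℤ ≈ ⟦ j ⟧ℤ)
  ⟦⟧ℤ-equal? i j = map (λ i≡j → reflexive (cong ⟦_⟧ℤ i≡j)) (dec⇒maybe (i ℤ.≟ j))

  open import Algebra.Solver.Ring ℤ.+-*-rawRing (fromCommutativeRing R) homomorphism ⟦⟧ℤ-equal?
    public using (Polynomial; solve; _:=_; con; _:+_; _:*_; _:-_)

  κ : ∀ {n} → ℕ → Polynomial n
  κ k = con (+ k)

module RealFieldProperties (R : RealField) where
  open RealOps R
  open IsTotalOrder isTotalOrder public
    using (total; antisym) renaming (refl to ≤-refl; reflexive to ≤-reflexive; trans to ≤-trans)
  open ≡-Reasoning

  commutativeRing : CommutativeRing 0ℓ 0ℓ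
  commutativeRing = record
    { Carrier = Carrier ; _≈_ = _≡_ ; _+_ = _+_ ; _*_ = _*_ ; -_ = -_ ; 0# = 0r ; 1# = 1r
    ; isCommutativeRing = isCommutativeRing }

  open CommutativeRing commutativeRing public
    using ( +-identityˡ; +-identityʳ; *-identityˡ; *-identityʳ; +-comm; +-assoc; *-assoc
          ; -‿inverseʳ; zeroˡ; zeroʳ; distribˡ)
  open import Algebra.Properties.Ring (CommutativeRing.ring commutativeRing) public
    using (+-cancelˡ; x∙y⁻¹≈ε⇒x≈y; x≈y⇒x∙y⁻¹≈ε)
  open import Algebra.Properties.CommutativeSemigroup (CommutativeRing.*-commutativeSemigroup commutativeRing)
    using (interchange)
  open IntegerCoefficientRingSolver commutativeRing public

  x≤y⇒0≤y-x : ∀ {x y} → x ≤ y → 0r ≤ y - x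
  x≤y⇒0≤y-x {x} x≤y = subst (_≤ _) (-‿inverseʳ x) (+-monoˡ-≤ (- x) x≤y)

  0≤y-x⇒x≤y : ∀ {x y} → 0r ≤ y - x → x ≤ y
  0≤y-x⇒x≤y {x} {y} 0≤y-x =
    subst₂ _≤_ (+-identityˡ x) (solve 2 (λ x y → y :- x :+ x := y) refl x y) (+-monoˡ-≤ x 0≤y-x)

  0≤1 : 0r ≤ 1r
  0≤1 with total 0r 1r
  ... | inj₁ 0≤1 = 0≤1
  ... | inj₂ 1≤0 = subst (0r ≤_) [0-1][0-1]≡1 (*-nonneg (x≤y⇒0≤y-x 1≤0) (x≤y⇒0≤y-x 1≤0))
    where
    [0-1][0-1]≡1 : (0r - 1r) * (0r - 1r) ≡ 1r
    [0-1][0-1]≡1 = solve 0 ((κ 0 :- κ 1) :* (κ 0 :- κ 1) := κ 1) refl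

  1≰0 : ¬ (1r ≤ 0r)
  1≰0 1≤0 = 0≢1 (antisym 0≤1 1≤0)

  +-nonneg : ∀ {x y} → 0r ≤ x → 0r ≤ y → 0r ≤ x + y
  +-nonneg {x} {y} 0≤x 0≤y = ≤-trans 0≤y (subst (_≤ x + y) (+-identityˡ y) (+-monoˡ-≤ y 0≤x))

  ^-nonneg : ∀ {x} → 0r ≤ x → ∀ j → 0r ≤ x ^ j
  ^-nonneg 0≤x zero = 0≤1
  ^-nonneg 0≤x (suc j) = *-nonneg 0≤x (^-nonneg 0≤x j)

  fromℕ-nonneg : ∀ n → 0r ≤ fromℕ n
  fromℕ-nonneg zero = ≤-refl
  fromℕ-nonneg (suc n) = +-nonneg 0≤1 (fromℕ-nonneg n)

  1+x≢0 : ∀ {x} → 0r ≤ x → 1r + x ≢ 0r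
  1+x≢0 {x} 0≤x 1+x≡0 =
    1≰0 (subst₂ _≤_ (+-identityˡ 1r) (trans (+-comm x 1r) 1+x≡0) (+-monoˡ-≤ 1r 0≤x))

  ⁻¹-nonneg : ∀ {x} → 0r ≤ x → x ≢ 0r → 0r ≤ x ⁻¹
  ⁻¹-nonneg {x} 0≤x x≢0 with total 0r (x ⁻¹)
  ... | inj₁ 0≤x⁻¹ = 0≤x⁻¹
  ... | inj₂ x⁻¹≤0 =
    ⊥-elim (1≰0 (0≤y-x⇒x≤y (subst (0r ≤_) x[0-x⁻¹]≡0-1 (*-nonneg 0≤x (x≤y⇒0≤y-x x⁻¹≤0)))))
    where
    x[0-x⁻¹]≡0-1 : x * (0r - x ⁻¹) ≡ 0r - 1r
    x[0-x⁻¹]≡0-1 = trans (solve 2 (λ x i → x :* (κ 0 :- i) := κ 0 :- x :* i) refl x (x ⁻¹))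
                         (cong (λ t → 0r - t) (⁻¹-inverse x x≢0))

  fromℕ-suc≢0 : ∀ n → fromℕ (suc n) ≢ 0r
  fromℕ-suc≢0 n = 1+x≢0 (fromℕ-nonneg n)

  fromℕ-injective : ∀ {m n} → fromℕ m ≡ fromℕ n → m ≡ n
  fromℕ-injective {zero} {zero} _ = refl
  fromℕ-injective {zero} {suc n} 0≡1+n = ⊥-elim (fromℕ-suc≢0 n (sym 0≡1+n))
  fromℕ-injective {suc m} {zero} 1+m≡0 = ⊥-elim (fromℕ-suc≢0 m 1+m≡0)
  fromℕ-injective {suc m} {suc n} 1+m≡1+n = cong suc (fromℕ-injective (+-cancelˡ 1r _ _ 1+m≡1+n))

  fromℕ-+ : ∀ m n → fromℕ (m ℕ.+ n) ≡ fromℕ m + fromℕ n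
  fromℕ-+ zero n = sym (+-identityˡ _)
  fromℕ-+ (suc m) n = trans (cong (1r +_) (fromℕ-+ m n)) (sym (+-assoc _ _ _))

  fromℕ-* : ∀ m n → fromℕ (m ℕ.* n) ≡ fromℕ m * fromℕ n
  fromℕ-* zero n = sym (zeroˡ _)
  fromℕ-* (suc m) n = begin
    fromℕ (n ℕ.+ m ℕ.* n)
      ≡⟨ fromℕ-+ n (m ℕ.* n) ⟩
    fromℕ n + fromℕ (m ℕ.* n)
      ≡⟨ cong (fromℕ n +_) (fromℕ-* m n) ⟩
    fromℕ n + fromℕ m * fromℕ n
      ≡⟨ solve 2 (λ a b → b :+ a :* b := (κ 1 :+ a) :* b) refl (fromℕ m) (fromℕ n) ⟩
    (1r + fromℕ m) * fromℕ n ∎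

  fromℕ-^ : ∀ m n → fromℕ (m ℕ.^ n) ≡ fromℕ m ^ n
  fromℕ-^ m zero = +-identityʳ 1r
  fromℕ-^ m (suc n) = trans (fromℕ-* m (m ℕ.^ n)) (cong (fromℕ m *_) (fromℕ-^ m n))

  ^-distrib-* : ∀ x y m → (x * y) ^ m ≡ x ^ m * y ^ m
  ^-distrib-* x y zero = sym (*-identityˡ 1r)
  ^-distrib-* x y (suc m) = trans (cong (x * y *_) (^-distrib-* x y m)) (interchange x y (x ^ m) (y ^ m))

  1^m≡1 : ∀ m → 1r ^ m ≡ 1r
  1^m≡1 zero = refl
  1^m≡1 (suc m) = trans (*-identityˡ _) (1^m≡1 m)

  uw≡1∧c[vw]^m≡1⇒cv^m≡u^m : ∀ {c u v w} m →
                            u * w ≡ 1r → c * (v * w) ^ m ≡ 1r → c * v ^ m ≡ u ^ m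
  uw≡1∧c[vw]^m≡1⇒cv^m≡u^m {c} {u} {v} {w} m uw≡1 c[vw]^m≡1 = begin
    c * v ^ m
      ≡⟨ *-identityʳ _ ⟨
    c * v ^ m * 1r
      ≡⟨ cong (c * v ^ m *_) (trans (cong (_^ m) uw≡1) (1^m≡1 m)) ⟨
    c * v ^ m * (u * w) ^ m
      ≡⟨ cong (c * v ^ m *_) (^-distrib-* u w m) ⟩
    c * v ^ m * (u ^ m * w ^ m)
      ≡⟨ solve 4 (λ c V U W → c :* V :* (U :* W) := U :* (c :* (V :* W)))
               refl c (v ^ m) (u ^ m) (w ^ m) ⟩
    u ^ m * (c * (v ^ m * w ^ m))
      ≡⟨ cong (λ t → u ^ m * (c * t)) (^-distrib-* v w m) ⟨
    u ^ m * (c * (v * w) ^ m)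
      ≡⟨ cong (u ^ m *_) c[vw]^m≡1 ⟩
    u ^ m * 1r
      ≡⟨ *-identityʳ _ ⟩
    u ^ m ∎

  x-y≡u-v⇒[x≡y⇔u≡v] : ∀ {x y u v} → x - y ≡ u - v → (x ≡ y ⇔ u ≡ v)
  x-y≡u-v⇒[x≡y⇔u≡v] {x} {y} {u} {v} eq = mk⇔
    (λ x≡y → x∙y⁻¹≈ε⇒x≈y u v (trans (sym eq) (x≈y⇒x∙y⁻¹≈ε x≡y)))
    (λ u≡v → x∙y⁻¹≈ε⇒x≈y x y (trans eq (x≈y⇒x∙y⁻¹≈ε u≡v)))

  sumFrom-+ : ∀ f s u v → sumFrom f s (u ℕ.+ v) ≡ sumFrom f s u + sumFrom f (s ℕ.+ u) v
  sumFrom-+ f s zero v = begin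
    sumFrom f s v                   ≡⟨ cong (λ t → sumFrom f t v) (ℕP.+-identityʳ s) ⟨
    sumFrom f (s ℕ.+ 0) v           ≡⟨ +-identityˡ _ ⟨
    0r + sumFrom f (s ℕ.+ 0) v      ∎
  sumFrom-+ f s (suc u) v = begin
    f s + sumFrom f (suc s) (u ℕ.+ v)
      ≡⟨ cong (f s +_) (sumFrom-+ f (suc s) u v) ⟩
    f s + (sumFrom f (suc s) u + sumFrom f (suc s ℕ.+ u) v)
      ≡⟨ +-assoc _ _ _ ⟨
    f s + sumFrom f (suc s) u + sumFrom f (suc s ℕ.+ u) v
      ≡⟨ cong (λ t → f s + sumFrom f (suc s) u + sumFrom f t v) (ℕP.+-suc s u) ⟨
    f s + sumFrom f (suc s) u + sumFrom f (s ℕ.+ suc u) v ∎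

  sumFrom-cong : ∀ {f g} s t c → (∀ j → j ℕ.< c → f (s ℕ.+ j) ≡ g (t ℕ.+ j)) →
                 sumFrom f s c ≡ sumFrom g t c
  sumFrom-cong s t zero _ = refl
  sumFrom-cong {f} {g} s t (suc c) f≗g = cong₂ _+_ head (sumFrom-cong (suc s) (suc t) c tail)
    where
    head : f s ≡ g t
    head = subst₂ (λ i k → f i ≡ g k) (ℕP.+-identityʳ s) (ℕP.+-identityʳ t) (f≗g 0 (s≤s z≤n))
    tail : ∀ j → j ℕ.< c → f (suc s ℕ.+ j) ≡ g (suc t ℕ.+ j)
    tail j j<c = subst₂ (λ i k → f i ≡ g k) (ℕP.+-suc s j) (ℕP.+-suc t j) (f≗g (suc j) (s≤s j<c))

  sumFrom-one : ∀ s c → sumFrom (λ _ → 1r) s c ≡ fromℕ c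
  sumFrom-one s zero = refl
  sumFrom-one s (suc c) = cong (1r +_) (sumFrom-one (suc s) c)

  sumFrom-affine : ∀ b c f s m → sumFrom (λ j → b - c * f j) s m ≡ b * fromℕ m - c * sumFrom f s m
  sumFrom-affine b c f s zero = solve 2 (λ b c → κ 0 := b :* κ 0 :- c :* κ 0) refl b c
  sumFrom-affine b c f s (suc m) = trans (cong (b - c * f s +_) (sumFrom-affine b c f (suc s) m))
    (solve 5 (λ b c x M S → b :- c :* x :+ (b :* M :- c :* S) := b :* (κ 1 :+ M) :- c :* (x :+ S))
           refl b c (f s) (fromℕ m) (sumFrom f (suc s) m))

  geometric-sum : ∀ r s m → (1r - r) * sumFrom (r ^_) s m ≡ r ^ s - r ^ (s ℕ.+ m)
  geometric-sum r s zero = begin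
    (1r - r) * 0r
      ≡⟨ solve 2 (λ r P → (κ 1 :- r) :* κ 0 := P :- P) refl r (r ^ s) ⟩
    r ^ s - r ^ s
      ≡⟨ cong (λ k → r ^ s - r ^ k) (ℕP.+-identityʳ s) ⟨
    r ^ s - r ^ (s ℕ.+ 0) ∎
  geometric-sum r s (suc m) = begin
    (1r - r) * (r ^ s + sumFrom (r ^_) (suc s) m)
      ≡⟨ distribˡ _ _ _ ⟩
    (1r - r) * r ^ s + (1r - r) * sumFrom (r ^_) (suc s) m
      ≡⟨ cong ((1r - r) * r ^ s +_) (geometric-sum r (suc s) m) ⟩
    (1r - r) * r ^ s + (r * r ^ s - r ^ (suc s ℕ.+ m))
      ≡⟨ solve 3 (λ r P E → (κ 1 :- r) :* P :+ (r :* P :- E) := P :- E)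
               refl r (r ^ s) (r ^ (suc s ℕ.+ m)) ⟩
    r ^ s - r ^ (suc s ℕ.+ m)
      ≡⟨ cong (λ k → r ^ s - r ^ k) (ℕP.+-suc s m) ⟨
    r ^ s - r ^ (s ℕ.+ suc m) ∎

module SumProfile (R : RealField) where
  open RealOps R
  open RealFieldProperties R
  open ≡-Reasoning

  module Setting
    (l m : ℕ) (1≤l : 1 ℕ.≤ l) (1≤m : 1 ℕ.≤ m)
    (x y F : Carrier) (a : ℕ → Carrier)
    (n≤x : fromℕ (l ℕ.+ m) ≤ x)
    (y≡ : y ≡ fromℕ 2 * (x - fromℕ (l ℕ.+ m)) + fromℕ (suc l) - 1r)
    (y≤F : y ≤ F) (F≤y+1 : F ≤ y + 1r)
    (a-flat : ∀ k → 2 ℕ.≤ k → k ℕ.≤ suc l → a k ≡ 1r)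
    (a-tail : ∀ k → suc (suc l) ℕ.≤ k → k ℕ.≤ suc (l ℕ.+ m) →
      a k ≡ fromℕ 2 - ((fromℕ 2 * F - y) / (F + 1r)) * (F / (F + 1r)) ^ (k ∸ suc l ∸ 1))
    where

    -- θ and Q keep the truncated-subtraction shapes of the statement, so that
    -- Equation is definitionally the equation of lemma7p5.
    w r c θ Q : Carrier
    w = (F + 1r) ⁻¹
    r = F / (F + 1r)
    c = (fromℕ 2 * F - y) / (F + 1r)
    θ = r ^ (suc (l ℕ.+ m) ∸ suc l)
    Q = fromℕ (2 ℕ.* (l ℕ.+ m) ∸ suc l ℕ.+ 1)

    Equation : Set
    Equation = (1r - fromℕ 2 * θ) * x ≡ fromℕ 2 * F * (1r - θ) - θ * Q

    θ≡r^m : θ ≡ r ^ m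
    θ≡r^m = cong (r ^_) (ℕP.m+n∸m≡n l m)

    Q≡[l+2m] : Q ≡ fromℕ (l ℕ.+ (m ℕ.+ m))
    Q≡[l+2m] = cong fromℕ (2[l+m]∸[1+l]+1≡l+[m+m] l m 1≤l)

    0≤y : 0r ≤ y
    0≤y = subst (0r ≤_) (sym y≡d+d+l) (+-nonneg (+-nonneg 0≤d 0≤d) (fromℕ-nonneg l))
      where
      d = x - fromℕ (l ℕ.+ m)
      0≤d : 0r ≤ d
      0≤d = x≤y⇒0≤y-x n≤x
      y≡d+d+l : y ≡ d + d + fromℕ l
      y≡d+d+l = trans y≡ (solve 2 (λ d L → κ 2 :* d :+ (κ 1 :+ L) :- κ 1 := d :+ d :+ L)
                                 refl d (fromℕ l))

    0≤F : 0r ≤ F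
    0≤F = ≤-trans 0≤y y≤F

    F+1≢0 : F + 1r ≢ 0r
    F+1≢0 F+1≡0 = 1+x≢0 0≤F (trans (+-comm 1r F) F+1≡0)

    [F+1]w≡1 : (F + 1r) * w ≡ 1r
    [F+1]w≡1 = ⁻¹-inverse (F + 1r) F+1≢0

    0≤w : 0r ≤ w
    0≤w = ⁻¹-nonneg (+-nonneg 0≤F 0≤1) F+1≢0

    0≤r : 0r ≤ r
    0≤r = *-nonneg 0≤F 0≤w

    0≤c : 0r ≤ c
    0≤c = *-nonneg (subst (0r ≤_) F+[F-y]≡2F-y (+-nonneg 0≤F (x≤y⇒0≤y-x y≤F))) 0≤w
      where
      F+[F-y]≡2F-y : F + (F - y) ≡ fromℕ 2 * F - y
      F+[F-y]≡2F-y = solve 2 (λ F y → F :+ (F :- y) := κ 2 :* F :- y) refl F y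

    1-r≡w : 1r - r ≡ w
    1-r≡w = begin
      1r - r                 ≡⟨ cong (_- r) [F+1]w≡1 ⟨
      (F + 1r) * w - F * w   ≡⟨ solve 2 (λ F w → (F :+ κ 1) :* w :- F :* w := w) refl F w ⟩
      w                      ∎

    1-c≡[y+1-F]w : 1r - c ≡ (y + 1r - F) * w
    1-c≡[y+1-F]w = begin
      1r - c
        ≡⟨ cong (_- c) [F+1]w≡1 ⟨
      (F + 1r) * w - (fromℕ 2 * F - y) * w
        ≡⟨ solve 3 (λ F y w → (F :+ κ 1) :* w :- (κ 2 :* F :- y) :* w := (y :+ κ 1 :- F) :* w)
                 refl F y w ⟩
      (y + 1r - F) * w ∎

    2-cr^j≤2-cr^[1+j] : ∀ j → fromℕ 2 - c * r ^ j ≤ fromℕ 2 - c * r ^ suc j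
    2-cr^j≤2-cr^[1+j] j =
      0≤y-x⇒x≤y (subst (0r ≤_) (sym increment) (*-nonneg (*-nonneg 0≤c (^-nonneg 0≤r j)) 0≤w))
      where
      increment : (fromℕ 2 - c * r ^ suc j) - (fromℕ 2 - c * r ^ j) ≡ c * r ^ j * w
      increment = trans
        (solve 3 (λ c r P → (κ 2 :- c :* (r :* P)) :- (κ 2 :- c :* P) := c :* P :* (κ 1 :- r))
                 refl c r (r ^ j))
                        (cong (c * r ^ j *_) 1-r≡w)

    1≤2-cr^0 : 1r ≤ fromℕ 2 - c * r ^ 0
    1≤2-cr^0 = 0≤y-x⇒x≤y (subst (0r ≤_) (sym increment) (*-nonneg (x≤y⇒0≤y-x F≤y+1) 0≤w))
      where
      increment : (fromℕ 2 - c * 1r) - 1r ≡ (y + 1r - F) * w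
      increment = trans (solve 1 (λ c → (κ 2 :- c :* κ 1) :- κ 1 := κ 1 :- c) refl c) 1-c≡[y+1-F]w

    a[2+l+j] : ∀ j → j ℕ.< m → a (2 ℕ.+ l ℕ.+ j) ≡ fromℕ 2 - c * r ^ j
    a[2+l+j] j j<m = trans (a-tail (2 ℕ.+ l ℕ.+ j) (ℕP.m≤m+n (2 ℕ.+ l) j) k≤n+1)
                           (cong (λ i → fromℕ 2 - c * r ^ i) index)
      where
      k≤n+1 : 2 ℕ.+ l ℕ.+ j ℕ.≤ suc (l ℕ.+ m)
      k≤n+1 = s≤s (subst (ℕ._≤ l ℕ.+ m) (ℕP.+-suc l j) (ℕP.+-monoʳ-≤ l j<m))
      index : 2 ℕ.+ l ℕ.+ j ∸ suc l ∸ 1 ≡ j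
      index = cong (_∸ 1) (trans (cong (_∸ l) (sym (ℕP.+-suc l j))) (ℕP.m+n∸m≡n l (suc j)))

    a-monotone : ∀ k → 2 ℕ.≤ k → k ℕ.< suc (l ℕ.+ m) → a k ≤ a (suc k)
    a-monotone k 2≤k k<n+1 with ℕP.<-cmp k (suc l)
    ... | tri< k<ℓ _ _ =
      ≤-reflexive (trans (a-flat k 2≤k (ℕP.<⇒≤ k<ℓ)) (sym (a-flat (suc k) (ℕP.m≤n⇒m≤1+n 2≤k) k<ℓ)))
    ... | tri≈ _ refl _ = subst₂ _≤_ (sym (a-flat (suc l) 2≤k ℕP.≤-refl)) (sym a[ℓ+1]) 1≤2-cr^0
      where
      a[ℓ+1] : a (suc (suc l)) ≡ fromℕ 2 - c * r ^ 0
      a[ℓ+1] = subst (λ i → a (suc (suc i)) ≡ fromℕ 2 - c * r ^ 0) (ℕP.+-identityʳ l) (a[2+l+j] 0 1≤m)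
    ... | tri> _ _ ℓ<k with ℕP.m≤n⇒∃[o]m+o≡n ℓ<k
    ...   | j , refl = subst₂ _≤_ (sym (a[2+l+j] j (ℕP.<⇒≤ 1+j<m))) (sym a[k+1]) (2-cr^j≤2-cr^[1+j] j)
      where
      1+j<m : suc j ℕ.< m
      1+j<m = ℕP.+-cancelˡ-≤ l _ _ (subst (ℕ._≤ l ℕ.+ m) 2+l+j≡l+[2+j] (ℕP.≤-pred k<n+1))
        where
        2+l+j≡l+[2+j] : suc (suc (l ℕ.+ j)) ≡ l ℕ.+ suc (suc j)
        2+l+j≡l+[2+j] = sym (trans (ℕP.+-suc l (suc j)) (cong suc (ℕP.+-suc l j)))
      a[k+1] : a (suc (2 ℕ.+ l ℕ.+ j)) ≡ fromℕ 2 - c * r ^ suc j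
      a[k+1] = trans (cong (λ i → a (suc (suc i))) (sym (ℕP.+-suc l j))) (a[2+l+j] (suc j) 1+j<m)

    sumFrom-a : sumFrom a 2 (l ℕ.+ m) ≡
                fromℕ l + (fromℕ 2 * fromℕ m - (fromℕ 2 * F - y) * (1r - r ^ m))
    sumFrom-a = begin
      sumFrom a 2 (l ℕ.+ m)
        ≡⟨ sumFrom-+ a 2 l m ⟩
      sumFrom a 2 l + sumFrom a (2 ℕ.+ l) m
        ≡⟨ cong₂ _+_ (sumFrom-cong 2 0 l a-flat′) (sumFrom-cong (2 ℕ.+ l) 0 m a[2+l+j]) ⟩
      sumFrom (λ _ → 1r) 0 l + sumFrom (λ j → fromℕ 2 - c * r ^ j) 0 m
        ≡⟨ cong₂ _+_ (sumFrom-one 0 l) (sumFrom-affine (fromℕ 2) c (r ^_) 0 m) ⟩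
      fromℕ l + (fromℕ 2 * fromℕ m - c * sumFrom (r ^_) 0 m)
        ≡⟨ cong (λ t → fromℕ l + (fromℕ 2 * fromℕ m - t)) c∑r^j ⟩
      fromℕ l + (fromℕ 2 * fromℕ m - (fromℕ 2 * F - y) * (1r - r ^ m)) ∎
      where
      a-flat′ : ∀ j → j ℕ.< l → a (2 ℕ.+ j) ≡ 1r
      a-flat′ j j<l = a-flat (2 ℕ.+ j) (s≤s (s≤s z≤n)) (s≤s j<l)
      c∑r^j : c * sumFrom (r ^_) 0 m ≡ (fromℕ 2 * F - y) * (1r - r ^ m)
      c∑r^j = begin
        (fromℕ 2 * F - y) * w * sumFrom (r ^_) 0 m
          ≡⟨ *-assoc _ _ _ ⟩
        (fromℕ 2 * F - y) * (w * sumFrom (r ^_) 0 m)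
          ≡⟨ cong (λ t → (fromℕ 2 * F - y) * (t * sumFrom (r ^_) 0 m)) 1-r≡w ⟨
        (fromℕ 2 * F - y) * ((1r - r) * sumFrom (r ^_) 0 m)
          ≡⟨ cong ((fromℕ 2 * F - y) *_) (geometric-sum r 0 m) ⟩
        (fromℕ 2 * F - y) * (1r - r ^ m) ∎

    sumFrom-a-x : sumFrom a 2 (l ℕ.+ m) - x ≡
                  (1r - fromℕ 2 * θ) * x - (fromℕ 2 * F * (1r - θ) - θ * Q)
    sumFrom-a-x = begin
      sumFrom a 2 (l ℕ.+ m) - x
        ≡⟨ cong (_- x) sumFrom-a ⟩
      L + (fromℕ 2 * M - (fromℕ 2 * F - y) * (1r - r ^ m)) - x
        ≡⟨ cong (λ t → L + (fromℕ 2 * M - (fromℕ 2 * F - t) * (1r - r ^ m)) - x) y≡′ ⟩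
      L + (fromℕ 2 * M - (fromℕ 2 * F - (fromℕ 2 * (x - (L + M)) + (1r + L) - 1r)) * (1r - r ^ m)) - x
        ≡⟨ solve 5 (λ L M F x θ →
             L :+ (κ 2 :* M :- (κ 2 :* F :- (κ 2 :* (x :- (L :+ M)) :+ (κ 1 :+ L) :- κ 1)) :* (κ 1 :- θ)) :- x
             := (κ 1 :- κ 2 :* θ) :* x :- (κ 2 :* F :* (κ 1 :- θ) :- θ :* (L :+ (M :+ M))))
           refl L M F x (r ^ m) ⟩
      (1r - fromℕ 2 * r ^ m) * x - (fromℕ 2 * F * (1r - r ^ m) - r ^ m * (L + (M + M)))
        ≡⟨ cong₂ (λ t q → (1r - fromℕ 2 * t) * x - (fromℕ 2 * F * (1r - t) - t * q))
                 (sym θ≡r^m) (sym Q≡L+[M+M]) ⟩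
      (1r - fromℕ 2 * θ) * x - (fromℕ 2 * F * (1r - θ) - θ * Q)
        ∎
      where
      L = fromℕ l
      M = fromℕ m
      y≡′ : y ≡ fromℕ 2 * (x - (L + M)) + (1r + L) - 1r
      y≡′ = trans y≡ (cong (λ N → fromℕ 2 * (x - N) + fromℕ (suc l) - 1r) (fromℕ-+ l m))
      Q≡L+[M+M] : Q ≡ L + (M + M)
      Q≡L+[M+M] = trans Q≡[l+2m] (trans (fromℕ-+ l (m ℕ.+ m)) (cong (L +_) (fromℕ-+ m m)))

    InA⇔Equation : InA (l ℕ.+ m) x a ⇔ Equation
    InA⇔Equation = mk⇔
      (λ (_ , _ , sum≡x) → Equivalence.to sum≡x⇔Equation sum≡x)
      (λ e → a-flat 2 ℕP.≤-refl (s≤s 1≤l) , a-monotone , Equivalence.from sum≡x⇔Equation e)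
      where
      sum≡x⇔Equation : sumFrom a 2 (l ℕ.+ m) ≡ x ⇔ Equation
      sum≡x⇔Equation = x-y≡u-v⇒[x≡y⇔u≡v] sumFrom-a-x

    2θ≡1∧Equation⇒2F≡Q : fromℕ 2 * θ ≡ 1r → Equation → fromℕ 2 * F ≡ Q
    2θ≡1∧Equation⇒2F≡Q 2θ≡1 e = x∙y⁻¹≈ε⇒x≈y _ _ (begin
      fromℕ 2 * F - Q
        ≡⟨ solve 3 (λ F Q x → κ 2 :* F :- Q
             := κ 2 :* F :* (κ 2 :- κ 1) :- κ 1 :* Q :- κ 2 :* (κ 1 :- κ 1) :* x)
           refl F Q x ⟩
      fromℕ 2 * F * (fromℕ 2 - 1r) - 1r * Q - fromℕ 2 * (1r - 1r) * x
        ≡⟨ cong (λ T → fromℕ 2 * F * (fromℕ 2 - T) - T * Q - fromℕ 2 * (1r - T) * x) 2θ≡1 ⟨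
      fromℕ 2 * F * (fromℕ 2 - fromℕ 2 * θ) - fromℕ 2 * θ * Q - fromℕ 2 * (1r - fromℕ 2 * θ) * x
        ≡⟨ solve 4 (λ F Q x θ →
             κ 2 :* F :* (κ 2 :- κ 2 :* θ) :- κ 2 :* θ :* Q :- κ 2 :* (κ 1 :- κ 2 :* θ) :* x
             := κ 2 :* ((κ 2 :* F :* (κ 1 :- θ) :- θ :* Q) :- (κ 1 :- κ 2 :* θ) :* x))
           refl F Q x θ ⟩
      fromℕ 2 * (fromℕ 2 * F * (1r - θ) - θ * Q - (1r - fromℕ 2 * θ) * x)
        ≡⟨ cong (fromℕ 2 *_) (x≈y⇒x∙y⁻¹≈ε (sym e)) ⟩
      fromℕ 2 * 0r
        ≡⟨ zeroʳ _ ⟩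
      0r ∎)

    Equation⇒θ≢½ : Equation → θ ≢ 1r / fromℕ 2
    Equation⇒θ≢½ e θ≡½ = 2p^m≢[p+2]^m 3≤p 1≤m (fromℕ-injective (begin
      fromℕ (2 ℕ.* p ℕ.^ m)
        ≡⟨ trans (fromℕ-* 2 (p ℕ.^ m)) (cong (fromℕ 2 *_) (fromℕ-^ p m)) ⟩
      fromℕ 2 * fromℕ p ^ m
        ≡⟨ cong (λ P → fromℕ 2 * P ^ m) 2F≡p ⟨
      fromℕ 2 * (fromℕ 2 * F) ^ m
        ≡⟨ uw≡1∧c[vw]^m≡1⇒cv^m≡u^m m [2F+2]w½≡1 2[2F·w½]^m≡1 ⟩
      (fromℕ 2 * F + fromℕ 2) ^ m
        ≡⟨ cong (λ P → (P + fromℕ 2) ^ m) 2F≡p ⟩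
      (fromℕ p + fromℕ 2) ^ m
        ≡⟨ trans (fromℕ-^ (p ℕ.+ 2) m) (cong (_^ m) (fromℕ-+ p 2)) ⟨
      fromℕ ((p ℕ.+ 2) ℕ.^ m) ∎))
      where
      p = l ℕ.+ (m ℕ.+ m)
      3≤p : 3 ℕ.≤ p
      3≤p = ℕP.+-mono-≤ 1≤l (ℕP.+-mono-≤ 1≤m 1≤m)
      ½ = fromℕ 2 ⁻¹
      2½≡1 : fromℕ 2 * ½ ≡ 1r
      2½≡1 = ⁻¹-inverse (fromℕ 2) (fromℕ-suc≢0 1)
      2θ≡1 : fromℕ 2 * θ ≡ 1r
      2θ≡1 = trans (cong (fromℕ 2 *_) (trans θ≡½ (*-identityˡ ½))) 2½≡1
      2F≡p : fromℕ 2 * F ≡ fromℕ p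
      2F≡p = trans (2θ≡1∧Equation⇒2F≡Q 2θ≡1 e) Q≡[l+2m]
      [2F+2]w½≡1 : (fromℕ 2 * F + fromℕ 2) * (w * ½) ≡ 1r
      [2F+2]w½≡1 = begin
        (fromℕ 2 * F + fromℕ 2) * (w * ½)
          ≡⟨ solve 3 (λ F w h → (κ 2 :* F :+ κ 2) :* (w :* h) := (F :+ κ 1) :* w :* (κ 2 :* h))
                   refl F w ½ ⟩
        (F + 1r) * w * (fromℕ 2 * ½)
          ≡⟨ cong₂ _*_ [F+1]w≡1 2½≡1 ⟩
        1r * 1r
          ≡⟨ *-identityʳ 1r ⟩
        1r ∎
      2F·w½≡r : fromℕ 2 * F * (w * ½) ≡ r
      2F·w½≡r = begin
        fromℕ 2 * F * (w * ½)
          ≡⟨ solve 3 (λ F w h → κ 2 :* F :* (w :* h) := F :* w :* (κ 2 :* h)) refl F w ½ ⟩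
        F * w * (fromℕ 2 * ½)
          ≡⟨ cong (F * w *_) 2½≡1 ⟩
        F * w * 1r
          ≡⟨ *-identityʳ r ⟩
        r ∎
      2[2F·w½]^m≡1 : fromℕ 2 * (fromℕ 2 * F * (w * ½)) ^ m ≡ 1r
      2[2F·w½]^m≡1 = begin
        fromℕ 2 * (fromℕ 2 * F * (w * ½)) ^ m
          ≡⟨ cong (λ t → fromℕ 2 * t ^ m) 2F·w½≡r ⟩
        fromℕ 2 * r ^ m
          ≡⟨ cong (fromℕ 2 *_) θ≡r^m ⟨
        fromℕ 2 * θ
          ≡⟨ 2θ≡1 ⟩
        1r ∎

lemma7p5 : (R : RealField) → let open RealOps R in
    (n : ℕ) → 2 ℕ.≤ n →
    (x : Carrier) → fromℕ n ≤ x → x ≤ (fromℕ (3 ℕ.* n) - 1r) / fromℕ 2 →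
    (ℓ : ℕ) → 2 ℕ.≤ ℓ → ℓ ℕ.≤ n →
    (y F : Carrier) →
    y ≡ fromℕ 2 * (x - fromℕ n) + fromℕ ℓ - 1r →
    y ≤ F → F < y + 1r →
    (a : ℕ → Carrier) →
    ((k : ℕ) → 2 ℕ.≤ k → k ℕ.≤ ℓ → a k ≡ 1r) →
    ((k : ℕ) → suc ℓ ℕ.≤ k → k ℕ.≤ suc n →
      a k ≡ fromℕ 2 - ((fromℕ 2 * F - y) / (F + 1r)) * (F / (F + 1r)) ^ (k ∸ ℓ ∸ 1)) →
    (θ : Carrier) → θ ≡ (F / (F + 1r)) ^ (suc n ∸ ℓ) →
    (InA n x a ⇔ ((1r - fromℕ 2 * θ) * x ≡ fromℕ 2 * F * (1r - θ) - θ * fromℕ (2 ℕ.* n ∸ ℓ ℕ.+ 1)))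
    × ((1r - fromℕ 2 * θ) * x ≡ fromℕ 2 * F * (1r - θ) - θ * fromℕ (2 ℕ.* n ∸ ℓ ℕ.+ 1) →
       ¬ (θ ≡ 1r / fromℕ 2))
lemma7p5 R n _ x n≤x _ (suc l) (s≤s 1≤l) ℓ≤n y F y≡ y≤F (F≤y+1 , _) a a-flat a-tail θ refl
  with ℕP.m≤n⇒∃[o]m+o≡n (ℕP.<⇒≤ ℓ≤n)
... | m , refl = InA⇔Equation , Equation⇒θ≢½
  where
  1≤m : 1 ℕ.≤ m
  1≤m = ℕP.+-cancelˡ-≤ l 1 m (subst (ℕ._≤ l ℕ.+ m) (ℕP.+-comm 1 l) ℓ≤n)
  open SumProfile.Setting R l m 1≤l 1≤m x y F a n≤x y≡ y≤F F≤y+1 a-flat a-tail
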